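{- Let $R$ be an integral domain. If there exists a connected graph $G$ that is neither a tree nor a cycle such that $(G,\alpha)$ satisfies the Universal Difference Property for every edge-labeling $\alpha$ of $G$ over $R$, then $R$ is a Prüfer domain.
   Context: An integral domain $R$ is a Prüfer domain if for all nonzero ideals $I,J,K$ of $R$, $I\cap(J+K)=(I\cap J)+(I\cap K)$. An edge-labeling assigns to each edge an ideal of $R$. A spline on $(G,\alpha)$ is a function $\rho:V(G)\to R$ with $\rho(u)-\rho(v)\in\alpha(uv)$ for every edge $uv$. A path has no repeated vertices; for a path $P$, $\alpha(P)$ is the sum of the labels of its edges. $(G,\alpha)$ satisfies the Universal Difference Property if for every pair of vertices $u,w$ and every $x\in\bigcap_P\alpha(P)$ (over all paths $P$ from $u$ to $w$ in $G$) there is a spline $\rho$ with $\rho(u)-\rho(w)=x$. -}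

module Defs where

open import Level using (Level; _⊔_; suc)
open import Algebra.Bundles using (CommutativeRing)
open import Data.Nat using (ℕ; _%_; _≤_; NonZero)
import Data.Nat as ℕ
open import Data.Fin using (Fin; toℕ; _≤?_)
open import Data.Bool using (Bool; true; false)
open import Data.List using (List; []; _∷_)
open import Data.List.Relation.Unary.Unique.Propositional using (Unique)
open import Data.Product using (Σ; ∃; ∃-syntax; _×_; _,_)
open import Data.Sum using (_⊎_)
open import Relation.Nullary using (¬_; yes; no)
open import Relation.Binary.PropositionalEquality using (_≡_)
open import Function.Bundles using (_↔_; Inverse; _⇔_)

module _ {c ℓ : Level} (R : CommutativeRing c ℓ) where
  open CommutativeRing R

  record IsIntegralDomain : Set (c ⊔ ℓ) where
    field
      1≉0          : ¬ (1# ≈ 0#)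
      noZeroDivisors : ∀ x y → x * y ≈ 0# → x ≈ 0# ⊎ y ≈ 0#

  record Ideal : Set (suc (c ⊔ ℓ)) where
    field
      _∈I_     : Carrier → Set (c ⊔ ℓ)
      ∈-resp-≈ : ∀ {x y} → x ≈ y → _∈I_ x → _∈I_ y
      0∈       : _∈I_ 0#
      +-closed : ∀ {x y} → _∈I_ x → _∈I_ y → _∈I_ (x + y)
      *-closed : ∀ r {x} → _∈I_ x → _∈I_ (r * x)
  open Ideal public

  _∈_ : Carrier → Ideal → Set (c ⊔ ℓ)
  x ∈ I = _∈I_ I x

  NonzeroIdeal : Ideal → Set (c ⊔ ℓ)
  NonzeroIdeal I = ∃[ x ] (x ∈ I × ¬ (x ≈ 0#))

  _∈_∩_ : Carrier → Ideal → Ideal → Set (c ⊔ ℓ)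
  x ∈ I ∩ J = x ∈ I × x ∈ J

  IsPruferDomain : Set (suc (c ⊔ ℓ))
  IsPruferDomain =
    IsIntegralDomain ×
    (∀ (I J K : Ideal) → NonzeroIdeal I → NonzeroIdeal J → NonzeroIdeal K →
      ∀ x →
        (x ∈ I × (∃[ a ] ∃[ b ] (a ∈ J × b ∈ K × x ≈ a + b)))
        ⇔ (∃[ a ] ∃[ b ] (a ∈ I ∩ J × b ∈ I ∩ K × x ≈ a + b)))

record SimpleGraph (n : ℕ) : Set where
  field
    adj     : Fin n → Fin n → Bool
    adj-sym : ∀ u v → adj u v ≡ adj v u
    irrefl  : ∀ u → adj u u ≡ false
open SimpleGraph public

module _ {n : ℕ} (G : SimpleGraph n) where

  Adj : Fin n → Fin n → Set
  Adj u v = adj G u v ≡ true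

  data Walk : Fin n → Fin n → Set where
    []  : ∀ {u} → Walk u u
    _∷_ : ∀ {u v w} → Adj u v → Walk v w → Walk u w

  vertices : ∀ {u w} → Walk u w → List (Fin n)
  vertices {u} []      = u ∷ []
  vertices {u} (_ ∷ p) = u ∷ vertices p

  numVertices : ∀ {u w} → Walk u w → ℕ
  numVertices []      = 1
  numVertices (_ ∷ p) = ℕ.suc (numVertices p)

  Path : Fin n → Fin n → Set
  Path u w = Σ (Walk u w) (λ p → Unique (vertices p))

  Connected : Set
  Connected = ∀ u v → Walk u v

  HasCycle : Set
  HasCycle = ∃[ u ] ∃[ w ] Σ (Path u w) (λ p →
               3 ≤ numVertices (Data.Product.proj₁ p) × Adj w u)

  IsTree : Set
  IsTree = Connected × ¬ HasCycle

  CycAdj : Fin n → Fin n → Set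
  CycAdj i j = Succ i j ⊎ Succ j i
    where
    Succ : Fin n → Fin n → Set
    Succ a b = (toℕ b ≡ ℕ.suc (toℕ a)) ⊎ (ℕ.suc (toℕ a) ≡ n × toℕ b ≡ 0)

  IsCycle : Set
  IsCycle = 3 ≤ n × Σ (Fin n ↔ Fin n) (λ π →
              ∀ i j → Adj (Inverse.to π i) (Inverse.to π j) ⇔ CycAdj i j)

module _ {c ℓ : Level} (R : CommutativeRing c ℓ) {n : ℕ} (G : SimpleGraph n) where
  open CommutativeRing R

  -- An edge labeling is given by a function on ordered pairs; the label of the
  -- (undirected) edge uv is read off at (min u v , max u v), so labels are
  -- symmetric and every assignment of ideals to edges arises this way.
  EdgeLabeling : Set (suc (c ⊔ ℓ))
  EdgeLabeling = Fin n → Fin n → Ideal R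

  label : EdgeLabeling → Fin n → Fin n → Ideal R
  label α u v with u ≤? v
  ... | yes _ = α u v
  ... | no  _ = α v u

  IsSpline : EdgeLabeling → (Fin n → Carrier) → Set (c ⊔ ℓ)
  IsSpline α ρ = ∀ u v → Adj G u v → _∈_ R (ρ u - ρ v) (label α u v)

  _∈Sum_ : ∀ {u w} → Carrier → (EdgeLabeling × Walk G u w) → Set (c ⊔ ℓ)
  x ∈Sum (α , [])          = Level.Lift (c ⊔ ℓ) (x ≈ 0#)
  x ∈Sum (α , _∷_ {u} {v} e p) =
    ∃[ a ] ∃[ b ] (_∈_ R a (label α u v) × b ∈Sum (α , p) × x ≈ a + b)

  UniversalDifferenceProperty : EdgeLabeling → Set (c ⊔ ℓ)
  UniversalDifferenceProperty α =
    ∀ u w (x : Carrier) →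
      (∀ (P : Path G u w) → x ∈Sum (α , Data.Product.proj₁ P)) →
      Σ (Fin n → Carrier) (λ ρ → IsSpline α ρ × (ρ u - ρ w ≈ x))

{-# OPTIONS --safe #-}

-- Label a branched cycle (a cycle v a ⋯ w v with one more edge y v) by I on yv, J on vw, K on the
-- other edges away from y, and the whole ring on the remaining edges at y. A path from y to w
-- either starts along a whole-ring edge or runs y v ⋯ w and ends in an edge labelled J or K, so
-- every x ∈ (I + J) ∩ (I + K) lies in α(P) for all of them, and the Universal Difference Property
-- gives a spline ρ with ρ(y) − ρ(w) = x. Then ρ(y) − ρ(v) ∈ I, while ρ(v) − ρ(w) lies in J (edge
-- vw) and in K (path v a ⋯ w), so x ∈ I + (J ∩ K). Used twice, this inclusion gives the Prüfer
-- identity I ∩ (J + K) ⊆ (I ∩ J) + (I ∩ K).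
--
-- A connected graph that is neither a tree nor a cycle contains a branched cycle: given a cycle,
-- a vertex off it yields an edge leaving the cycle, and if there is none, the graph is not the
-- cycle itself and so has a chord. Branched cycles are found by finite search, so refuting their
-- absence suffices.

module Submission where

open import Defs
open import Level using (Level; _⊔_; lift)
open import Algebra.Bundles using (CommutativeRing)
open import Data.Bool using (true)
import Data.Bool.Properties as Bool
open import Data.Empty using (⊥-elim)
open import Data.Fin using (Fin; toℕ)
open import Data.Fin.Properties using (_≟_; any?)
import Data.List.Relation.Unary.All as All
open import Data.List.Relation.Unary.AllPairs using (_∷_)
open import Data.List.Relation.Unary.Any using (here; there)
open import Data.List.Relation.Unary.Unique.Propositional using (Unique)
import Data.List.Membership.Propositional as List
open import Data.Nat using (ℕ)
open import Data.Product as Prod using (Σ; _×_; _,_; ∃-syntax; proj₁; proj₂)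
open import Data.Sum as Sum using (_⊎_; inj₁; inj₂)
open import Function.Base using (_∘_)
open import Function.Bundles using (_↔_; mk⇔; mk↔ₛ′)
open import Relation.Nullary using (¬_; Dec; yes; no)
open import Relation.Nullary.Decidable using (_×-dec_; _⊎-dec_; ¬?; map′; decidable-stable)
open import Relation.Unary using (Decidable)
open import Relation.Binary.PropositionalEquality using (_≡_; _≢_)

infix 4 _∈ᵢ_

_∈ᵢ_ : ∀ {c ℓ} {R : CommutativeRing c ℓ} →
       CommutativeRing.Carrier R → Ideal R → Set (c ⊔ ℓ)
_∈ᵢ_ {R = R} x I = _∈_ R x I

module IdealProperties {c ℓ : Level} (R : CommutativeRing c ℓ) where
  open CommutativeRing R
  open import Relation.Binary.Reasoning.Setoid setoid

  [x-y]+[y-z]≈x-z : ∀ x y z → (x - y) + (y - z) ≈ x - z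
  [x-y]+[y-z]≈x-z x y z = begin
    (x - y) + (y - z)   ≈⟨ +-assoc x (- y) (y - z) ⟩
    x + (- y + (y - z)) ≈⟨ +-congˡ (+-assoc (- y) y (- z)) ⟨
    x + ((- y + y) - z) ≈⟨ +-congˡ (+-congʳ (-‿inverseˡ y)) ⟩
    x + (0# - z)        ≈⟨ +-congˡ (+-identityˡ (- z)) ⟩
    x - z               ∎

  x-x∈ : ∀ (I : Ideal R) x → x - x ∈ᵢ I
  x-x∈ I x = ∈-resp-≈ I (sym (-‿inverseʳ x)) (0∈ I)

  infixr 7 _∩ᵢ_
  infix 8 _⇒ᵢ_

  _∩ᵢ_ : Ideal R → Ideal R → Ideal R
  I ∩ᵢ J = record
    { _∈I_     = λ x → x ∈ᵢ I × x ∈ᵢ J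
    ; ∈-resp-≈ = λ x≈y (x∈I , x∈J) → ∈-resp-≈ I x≈y x∈I , ∈-resp-≈ J x≈y x∈J
    ; 0∈       = 0∈ I , 0∈ J
    ; +-closed = λ (x∈I , x∈J) (y∈I , y∈J) → +-closed I x∈I y∈I , +-closed J x∈J y∈J
    ; *-closed = λ r (x∈I , x∈J) → *-closed I r x∈I , *-closed J r x∈J
    }

  _⇒ᵢ_ : Set → Ideal R → Ideal R
  P ⇒ᵢ I = record
    { _∈I_     = λ x → P → x ∈ᵢ I
    ; ∈-resp-≈ = λ x≈y x∈ p → ∈-resp-≈ I x≈y (x∈ p)
    ; 0∈       = λ _ → 0∈ I
    ; +-closed = λ x∈ y∈ p → +-closed I (x∈ p) (y∈ p)
    ; *-closed = λ r x∈ p → *-closed I r (x∈ p)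
    }

  infix 4 _∈_⊕_

  _∈_⊕_ : Carrier → Ideal R → Ideal R → Set (c ⊔ ℓ)
  x ∈ I ⊕ J = ∃[ a ] ∃[ b ] (a ∈ᵢ I × b ∈ᵢ J × x ≈ a + b)

  ∈⊕-comm : ∀ I J {x} → x ∈ I ⊕ J → x ∈ J ⊕ I
  ∈⊕-comm _ _ (a , b , a∈I , b∈J , x≈a+b) = b , a , b∈J , a∈I , trans x≈a+b (+-comm a b)

  ∈⊕ʳ : ∀ I J {x} → x ∈ᵢ J → x ∈ I ⊕ J
  ∈⊕ʳ I _ {x} x∈J = 0# , x , 0∈ I , x∈J , sym (+-identityˡ x)

  DualDistributive : Set (Level.suc (c ⊔ ℓ))
  DualDistributive = ∀ (I J K : Ideal R) {x} → x ∈ I ⊕ J → x ∈ I ⊕ K → x ∈ I ⊕ (J ∩ᵢ K)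

  dualDistributive⇒Prüfer : IsIntegralDomain R → DualDistributive → IsPruferDomain R
  dualDistributive⇒Prüfer domain distrib = domain , λ I J K _ _ _ x → mk⇔ (to I J K) (from I J K)
    where
    to : ∀ I J K {x} → x ∈ᵢ I × x ∈ J ⊕ K → x ∈ (I ∩ᵢ J) ⊕ (I ∩ᵢ K)
    to I J K (x∈I , x∈J⊕K) =
      let x∈K⊕I∩J = distrib K I J (∈⊕ʳ K I x∈I) (∈⊕-comm J K x∈J⊕K)
      in distrib (I ∩ᵢ J) I K (∈⊕ʳ (I ∩ᵢ J) I x∈I) (∈⊕-comm K (I ∩ᵢ J) x∈K⊕I∩J)

    from : ∀ I J K {x} → x ∈ (I ∩ᵢ J) ⊕ (I ∩ᵢ K) → x ∈ᵢ I × x ∈ J ⊕ K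
    from I J K (a , b , (a∈I , a∈J) , (b∈I , b∈K) , x≈a+b) =
      ∈-resp-≈ I (sym x≈a+b) (+-closed I a∈I b∈I) , a , b , a∈J , b∈K , x≈a+b

module _ where
  open import Data.Nat using (suc; _+_; _∸_; _<_; _<?_; NonZero)
  open import Data.Nat.Properties
    using (<⇒≢; ≮⇒≥; m<n+m; m∸n+n≡m; +-cancelʳ-≡; +-cancelʳ-<; +-mono-<; +-comm)
  open import Data.Nat.DivMod using (_%_; %-distribˡ-+; m<n⇒m%n≡m; m%n<n; m%n%n≡m%n; [m+n]%n≡m%n)
  open import Relation.Binary.PropositionalEquality using (sym; trans; cong; subst)

  [1+m]%n≡[1+m%n]%n : ∀ m n .{{_ : NonZero n}} → suc m % n ≡ suc (m % n) % n
  [1+m]%n≡[1+m%n]%n m n = trans (%-distribˡ-+ 1 m n)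
    (sym (trans (%-distribˡ-+ 1 (m % n) n) (cong (λ t → (1 % n + t) % n) (m%n%n≡m%n m n))))

  [d+m]%n≢m%n : ∀ {d} m n .{{_ : NonZero n}} → 0 < d → d < n → (d + m) % n ≢ m % n
  [d+m]%n≢m%n {d} m n 0<d d<n eq = [d+r]%n≢r (trans (sym [d+m]%n≡[d+r]%n) eq)
    where
    r : ℕ
    r = m % n

    [d+m]%n≡[d+r]%n : (d + m) % n ≡ (d + r) % n
    [d+m]%n≡[d+r]%n = trans (%-distribˡ-+ d m n) (cong (λ t → (t + r) % n) (m<n⇒m%n≡m d<n))

    [d+r]%n≢r : (d + r) % n ≢ r
    [d+r]%n≢r with d + r <? n
    ... | yes d+r<n = λ eq → <⇒≢ (m<n+m r 0<d) (sym (trans (sym (m<n⇒m%n≡m d+r<n)) eq))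
    ... | no  d+r≮n = λ eq → <⇒≢ d<n (d≡n (trans (sym (m<n⇒m%n≡m t<n)) (trans (sym t%n) eq)))
      where
      t : ℕ
      t = d + r ∸ n
      t+n≡d+r : t + n ≡ d + r
      t+n≡d+r = m∸n+n≡m (≮⇒≥ d+r≮n)
      t<n : t < n
      t<n = +-cancelʳ-< n t n (subst (_< n + n) (sym t+n≡d+r) (+-mono-< d<n (m%n<n m n)))
      t%n : (d + r) % n ≡ t % n
      t%n = trans (cong (_% n) (sym t+n≡d+r)) ([m+n]%n≡m%n t n)
      d≡n : t ≡ r → d ≡ n
      d≡n t≡r = +-cancelʳ-≡ r d n (trans (sym t+n≡d+r) (trans (cong (_+ n) t≡r) (+-comm r n)))

module GraphProperties {n : ℕ} (G : SimpleGraph n) where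
  open import Data.Nat
    using (zero; suc; _+_; _*_; _∸_; _≤_; _<_; _<?_; z≤n; s≤s; s≤s⁻¹; NonZero; nonZero)
  open import Data.Nat.Properties
    using (≤-refl; ≤-trans; ≤-antisym; <⇒≤; <⇒≢; ≮⇒≥; <-cmp; <-irrefl; ≤-<-trans; <-≤-trans;
           n≤1+n; m≤n⇒m≤1+n; m≤m+n; m≤n+m; m+1+n≰m; m<n⇒0<n∸m; m∸n≤m; m∸n+n≡m;
           m≤n⇒∃[o]m+o≡n; +-identityʳ; +-assoc; +-commutativeSemigroup)
  open import Algebra.Properties.CommutativeSemigroup +-commutativeSemigroup
    using (xy∙z≈xz∙y; x∙yz≈xz∙y)
  open import Data.Nat.DivMod
    using (_%_; _/_; m<n⇒m%n≡m; m%n<n; n%n≡0; [m+n]%n≡m%n; m≡m%n+[m/n]*n)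
  open import Data.Fin using (fromℕ<; cast)
  open import Data.Fin.Properties using (toℕ<n; toℕ-injective; toℕ-fromℕ<; toℕ-cast; injective⇒≤)
  open import Relation.Binary.Definitions using (tri<; tri≈; tri>)
  open import Relation.Binary.PropositionalEquality using (refl; sym; trans; cong; subst; subst₂)

  Adj-sym : ∀ {u v} → Adj G u v → Adj G v u
  Adj-sym {u} {v} u~v = trans (adj-sym G v u) u~v

  Adj⇒≢ : ∀ {u v} → Adj G u v → u ≢ v
  Adj⇒≢ {u} u~u refl with trans (sym (irrefl G u)) u~u
  ... | ()

  adj? : ∀ u v → Dec (Adj G u v)
  adj? u v = adj G u v Bool.≟ true

  -- Bounded by a step count so that it is decidable.
  Reach : (Fin n → Set) → ℕ → Fin n → Fin n → Set
  Reach P zero    a b = a ≡ b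
  Reach P (suc m) a b = a ≡ b ⊎ ∃[ d ] (Adj G a d × P d × Reach P m d b)

  reach? : ∀ {P} → Decidable P → ∀ m a b → Dec (Reach P m a b)
  reach? P? zero    a b = a ≟ b
  reach? P? (suc m) a b = a ≟ b ⊎-dec any? λ d → adj? a d ×-dec P? d ×-dec reach? P? m d b

  reach-mono : ∀ {P m m' a b} → m ≤ m' → Reach P m a b → Reach P m' a b
  reach-mono {m = zero}  {zero}   _         a≡b              = a≡b
  reach-mono {m = zero}  {suc _}  _         a≡b              = inj₁ a≡b
  reach-mono {m = suc _} {suc _}  _         (inj₁ a≡b)       = inj₁ a≡b
  reach-mono {m = suc _} {suc _}  (s≤s m≤m') (inj₂ (d , a~d , Pd , r)) =
    inj₂ (d , a~d , Pd , reach-mono m≤m' r)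

  reach-along : ∀ {P} (f : ℕ → Fin n) → (∀ i → Adj G (f i) (f (suc i))) →
                ∀ m → (∀ i → i < m → P (f (suc i))) → Reach P m (f 0) (f m)
  reach-along f step zero    _  = refl
  reach-along f step (suc m) Pf =
    inj₂ (f 1 , step 0 , Pf 0 (s≤s z≤n) ,
          reach-along (λ i → f (suc i)) (λ i → step (suc i)) m (λ i i<m → Pf (suc i) (s≤s i<m)))

  leaving-edge : ∀ {S : Fin n → Set} → Decidable S → ∀ {p q} → Walk G p q → S p → ¬ S q →
                 ∃[ u ] ∃[ z ] (Adj G u z × S u × ¬ S z)
  leaving-edge S? []                         Sp ¬Sq = ⊥-elim (¬Sq Sp)
  leaving-edge S? (_∷_ {p} {b} p~b P) Sp ¬Sq with S? b
  ... | yes Sb = leaving-edge S? P Sb ¬Sq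
  ... | no ¬Sb = p , b , p~b , Sp , ¬Sb

  record BranchedCycle : Set where
    field
      v y w a : Fin n
      y~v     : Adj G y v
      v~w     : Adj G v w
      v~a     : Adj G v a
      a≢w     : a ≢ w
      w≢y     : w ≢ y
      a≢y     : a ≢ y
      a⇝w     : Reach (λ d → d ≢ y × d ≢ v) n a w

  branchedCycle? : Dec BranchedCycle
  branchedCycle? = map′
    (λ (v , y , w , a , y~v , v~w , v~a , a≢w , w≢y , a≢y , a⇝w) → record
      { v = v ; y = y ; w = w ; a = a ; y~v = y~v ; v~w = v~w ; v~a = v~a
      ; a≢w = a≢w ; w≢y = w≢y ; a≢y = a≢y ; a⇝w = a⇝w })
    (λ B → let open BranchedCycle B in v , y , w , a , y~v , v~w , v~a , a≢w , w≢y , a≢y , a⇝w)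
    (any? λ v → any? λ y → any? λ w → any? λ a →
      adj? y v ×-dec adj? v w ×-dec adj? v a ×-dec ¬? (a ≟ w) ×-dec ¬? (w ≟ y) ×-dec ¬? (a ≟ y)
      ×-dec reach? (λ d → ¬? (d ≟ y) ×-dec ¬? (d ≟ v)) n a w)

  infixl 9 _at_

  _at_ : ∀ {u w} → Walk G u w → ℕ → Fin n
  _at_ {u} []      _       = u
  _at_ {u} (_ ∷ _) zero    = u
  (_ ∷ P)  at suc i        = P at i

  at-0 : ∀ {u w} (P : Walk G u w) → P at 0 ≡ u
  at-0 []      = refl
  at-0 (_ ∷ _) = refl

  at-step : ∀ {u w} (P : Walk G u w) {i} → suc i < numVertices G P → Adj G (P at i) (P at suc i)
  at-step []        (s≤s ())
  at-step (u~b ∷ P) {zero}  _          = subst (Adj G _) (sym (at-0 P)) u~b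
  at-step (_ ∷ P)   {suc i} (s≤s i<P) = at-step P i<P

  at-end : ∀ {u w} (P : Walk G u w) {i} → numVertices G P ≤ suc i → P at i ≡ w
  at-end []            _          = refl
  at-end (_ ∷ [])      {zero} (s≤s ())
  at-end (_ ∷ _ ∷ _)   {zero} (s≤s ())
  at-end (_ ∷ P)       {suc i} (s≤s P≤i) = at-end P P≤i

  at-∈ : ∀ {u w} (P : Walk G u w) {i} → i < numVertices G P → P at i List.∈ vertices G P
  at-∈ []      {zero}  _          = here refl
  at-∈ []      {suc i} (s≤s ())
  at-∈ (_ ∷ P) {zero}  _          = here refl
  at-∈ (_ ∷ P) {suc i} (s≤s i<P) = there (at-∈ P i<P)

  at-injective : ∀ {u w} (P : Walk G u w) → Unique (vertices G P) → ∀ {i j} →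
                 i < numVertices G P → j < numVertices G P → P at i ≡ P at j → i ≡ j
  at-injective []      _           {zero}  {zero}  _          _          _ = refl
  at-injective []      _           {suc _} {_}     (s≤s ())   _          _
  at-injective []      _           {zero}  {suc _} _          (s≤s ())   _
  at-injective (_ ∷ P) _           {zero}  {zero}  _          _          _ = refl
  at-injective (_ ∷ P) (u∉P ∷ _)   {zero}  {suc j} _          (s≤s j<P) u≡ =
    ⊥-elim (All.lookup u∉P (at-∈ P j<P) u≡)
  at-injective (_ ∷ P) (u∉P ∷ _)   {suc i} {zero}  (s≤s i<P) _          ≡u =
    ⊥-elim (All.lookup u∉P (at-∈ P i<P) (sym ≡u))
  at-injective (_ ∷ P) (_ ∷ uniq)  {suc i} {suc j} (s≤s i<P) (s≤s j<P) eq =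
    cong suc (at-injective P uniq i<P j<P eq)

  -- Indexed by ℕ and periodic, so that rotating a cycle is a shift of the index.
  record Cycle (k : ℕ) : Set where
    field
      vertex   : ℕ → Fin n
      step     : ∀ i → Adj G (vertex i) (vertex (suc i))
      periodic : ∀ i → vertex (i + k) ≡ vertex i
      apart    : ∀ s {d} → 0 < d → d < k → vertex (d + s) ≢ vertex s

  rotate : ∀ {k} → ℕ → Cycle k → Cycle k
  rotate {k} r C = record
    { vertex   = λ i → vertex (i + r)
    ; step     = λ i → step (i + r)
    ; periodic = λ i → trans (cong vertex (xy∙z≈xz∙y i k r)) (periodic (i + r))
    ; apart    = λ s 0<d d<k eq → apart (s + r) 0<d d<k (trans (cong vertex (sym (+-assoc _ s r))) eq)
    }
    where
    open Cycle C

  numVertices-nonZero : ∀ {u w} (P : Walk G u w) → NonZero (numVertices G P)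
  numVertices-nonZero []      = nonZero
  numVertices-nonZero (_ ∷ _) = nonZero

  pathCycle : ∀ {u w} (P : Walk G u w) → Unique (vertices G P) → Adj G w u → Cycle (numVertices G P)
  pathCycle {u} {w} P unique w~u = record
    { vertex   = vertex
    ; step     = step
    ; periodic = λ i → cong (P at_) ([m+n]%n≡m%n i k)
    ; apart    = λ s 0<d d<k eq →
        [d+m]%n≢m%n s k 0<d d<k (at-injective P unique (m%n<n _ k) (m%n<n s k) eq)
    }
    where
    k : ℕ
    k = numVertices G P

    instance
      k≢0 : NonZero k
      k≢0 = numVertices-nonZero P

    vertex : ℕ → Fin n
    vertex i = P at (i % k)

    step : ∀ i → Adj G (vertex i) (vertex (suc i))
    step i with suc (i % k) <? k
    ... | yes 1+r<k = subst (λ t → Adj G (vertex i) (P at t))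
                            (sym (trans ([1+m]%n≡[1+m%n]%n i k) (m<n⇒m%n≡m 1+r<k))) (at-step P 1+r<k)
    ... | no  1+r≮k = subst₂ (Adj G) (sym vᵢ≡w) (sym v₁₊ᵢ≡u) w~u
      where
      1+r≡k : suc (i % k) ≡ k
      1+r≡k = ≤-antisym (m%n<n i k) (≮⇒≥ 1+r≮k)

      vᵢ≡w : vertex i ≡ w
      vᵢ≡w = at-end P (≮⇒≥ 1+r≮k)

      v₁₊ᵢ≡u : vertex (suc i) ≡ u
      v₁₊ᵢ≡u = trans (cong (P at_) 1+i%k≡0) (at-0 P)
        where
        1+i%k≡0 : suc i % k ≡ 0
        1+i%k≡0 = trans ([1+m]%n≡[1+m%n]%n i k) (trans (cong (_% k) 1+r≡k) (n%n≡0 k))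

  hasCycle⇒cycle : HasCycle G → ∃[ m ] Cycle (3 + m)
  hasCycle⇒cycle (_ , _ , (P , unique) , 3≤k , w~u) =
    let m , 3+m≡k = m≤n⇒∃[o]m+o≡n 3≤k in m , subst Cycle (sym 3+m≡k) (pathCycle P unique w~u)

  module CycleProperties {m} (C : Cycle (3 + m)) where
    open Cycle C

    injective : ∀ {i j} → i < 3 + m → j < 3 + m → vertex i ≡ vertex j → i ≡ j
    injective {i} {j} i<k j<k eq with <-cmp i j
    ... | tri< i<j _ _ = ⊥-elim (apart i (m<n⇒0<n∸m i<j) (≤-<-trans (m∸n≤m j i) j<k)
                                  (trans (cong vertex (m∸n+n≡m (<⇒≤ i<j))) (sym eq)))
    ... | tri≈ _ i≡j _ = i≡j
    ... | tri> _ _ j<i = ⊥-elim (apart j (m<n⇒0<n∸m j<i) (≤-<-trans (m∸n≤m i j) i<k)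
                                  (trans (cong vertex (m∸n+n≡m (<⇒≤ j<i))) eq))

    vertex-≢ : ∀ {i j} → i < 3 + m → j < 3 + m → i ≢ j → vertex i ≢ vertex j
    vertex-≢ i<k j<k i≢j eq = i≢j (injective i<k j<k eq)

    vertex-mod : ∀ i → vertex i ≡ vertex (i % (3 + m))
    vertex-mod i = trans (cong vertex (m≡m%n+[m/n]*n i (3 + m))) (vertex-+* (i % (3 + m)) (i / (3 + m)))
      where
      vertex-+* : ∀ r q → vertex (r + q * (3 + m)) ≡ vertex r
      vertex-+* r zero    = cong vertex (+-identityʳ r)
      vertex-+* r (suc q) =
        trans (cong vertex (x∙yz≈xz∙y r (3 + m) _)) (trans (periodic _) (vertex-+* r q))

    length≤n : 3 + m ≤ n
    length≤n = injective⇒≤ λ {i} {j} eq → toℕ-injective (injective (toℕ<n i) (toℕ<n j) eq)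

    closing : Adj G (vertex (2 + m)) (vertex 0)
    closing = subst (Adj G _) (periodic 0) (step (2 + m))

    offCycleNeighbour⇒branched : ∀ {z} → (∀ i → vertex i ≢ z) → Adj G (vertex 0) z →
                                 BranchedCycle
    offCycleNeighbour⇒branched {z} off v₀~z = record
      { v = vertex 0 ; y = z ; w = vertex (2 + m) ; a = vertex 1
      ; y~v = Adj-sym v₀~z ; v~w = Adj-sym closing ; v~a = step 0
      ; a≢w = vertex-≢ 1<k ≤-refl (λ ()) ; w≢y = off (2 + m) ; a≢y = off 1
      ; a⇝w = reach-mono (≤-trans (m≤n+m (suc m) 2) length≤n)
                (reach-along (λ i → vertex (suc i)) (λ i → step (suc i)) (suc m)
                  (λ i i<1+m → off (2 + i) , vertex-≢ (s≤s (s≤s i<1+m)) 0<k (λ ())))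
      }
      where
      0<k : 0 < 3 + m
      0<k = s≤s z≤n
      1<k : 1 < 3 + m
      1<k = s≤s (s≤s z≤n)

    chord⇒branched : ∀ {j} → 2 ≤ j → j < 2 + m → Adj G (vertex 0) (vertex j) → BranchedCycle
    chord⇒branched {suc d} (s≤s 1≤d) (s≤s d<1+m) v₀~vⱼ = record
      { v = vertex 0 ; y = vertex (2 + m) ; w = vertex (suc d) ; a = vertex 1
      ; y~v = closing ; v~w = v₀~vⱼ ; v~a = step 0
      ; a≢w = vertex-≢ 1<k j<k (<⇒≢ (s≤s 1≤d))
      ; w≢y = vertex-≢ j<k ≤-refl (<⇒≢ (s≤s d<1+m))
      ; a≢y = vertex-≢ 1<k ≤-refl (λ ())
      ; a⇝w = reach-mono (≤-trans (n≤1+n d) (≤-trans (<⇒≤ j<k) length≤n))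
                (reach-along (λ i → vertex (suc i)) (λ i → step (suc i)) d
                  (λ i i<d → vertex-≢ (2+i<k i<d) ≤-refl (2+i≢2+m i<d)
                           , vertex-≢ (2+i<k i<d) (s≤s z≤n) (λ ())))
      }
      where
      1<k : 1 < 3 + m
      1<k = s≤s (s≤s z≤n)
      j<k : suc d < 3 + m
      j<k = m≤n⇒m≤1+n (s≤s d<1+m)
      2+i<k : ∀ {i} → i < d → 2 + i < 3 + m
      2+i<k i<d = s≤s (s≤s (<-≤-trans i<d (<⇒≤ d<1+m)))
      2+i≢2+m : ∀ {i} → i < d → 2 + i ≢ 2 + m
      2+i≢2+m i<d = <⇒≢ (s≤s (s≤s (<-≤-trans i<d (s≤s⁻¹ d<1+m))))

  module _ (connected : Connected G) (¬branched : ¬ BranchedCycle) {m} (C : Cycle (3 + m)) where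
    open Cycle C
    open CycleProperties C

    OnCycle : Fin n → Set
    OnCycle z = ∃[ i ] (vertex (toℕ {3 + m} i) ≡ z)

    vertex-onCycle : ∀ i → OnCycle (vertex i)
    vertex-onCycle i = fromℕ< (m%n<n i (3 + m)) , trans (cong vertex (toℕ-fromℕ< _)) (sym (vertex-mod i))

    onCycle : ∀ z → OnCycle z
    onCycle z = decidable-stable (onCycle? z) λ z∉C →
      let u , z′ , u~z′ , (r , vᵣ≡u) , z′∉C =
            leaving-edge onCycle? (connected (vertex 0) z) (vertex-onCycle 0) z∉C
      in ¬branched (CycleProperties.offCycleNeighbour⇒branched (rotate (toℕ r) C)
                      (λ i vᵢ≡z′ → z′∉C (subst OnCycle vᵢ≡z′ (vertex-onCycle _)))
                      (subst (λ t → Adj G t z′) (sym vᵣ≡u) u~z′))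
      where
      onCycle? : Decidable OnCycle
      onCycle? z = any? λ i → vertex (toℕ i) ≟ z

    chordless : ∀ {i j} → i < j → j < 3 + m → Adj G (vertex i) (vertex j) →
                j ≡ suc i ⊎ (i ≡ 0 × suc j ≡ 3 + m)
    chordless {i} {j} i<j j<k vᵢ~vⱼ with j ∸ i | m∸n+n≡m (<⇒≤ i<j)
    ... | zero            | refl = ⊥-elim (<-irrefl refl i<j)
    ... | suc zero        | refl = inj₁ refl
    ... | d@(suc (suc _)) | refl with d <? 2 + m
    ...   | yes d<2+m =
      ⊥-elim (¬branched (CycleProperties.chord⇒branched (rotate i C) (s≤s (s≤s z≤n)) d<2+m vᵢ~vⱼ))
    ...   | no  d≮2+m =
      inj₂ (i≡0 (s≤s⁻¹ (<-≤-trans j<k k≤1+d)) , ≤-antisym j<k (≤-trans k≤1+d (s≤s (m≤m+n d i))))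
      where
      k≤1+d : 3 + m ≤ suc d
      k≤1+d = s≤s (≮⇒≥ d≮2+m)
      i≡0 : ∀ {i} → d + i ≤ d → i ≡ 0
      i≡0 {zero}  _   = refl
      i≡0 {suc _} d+i≤d = ⊥-elim (m+1+n≰m d d+i≤d)

    length≡n : 3 + m ≡ n
    length≡n = ≤-antisym length≤n (injective⇒≤ λ {z} {z′} eq →
      trans (sym (proj₂ (onCycle z))) (trans (cong (λ i → vertex (toℕ i)) eq) (proj₂ (onCycle z′))))

    toℕ<length : ∀ (i : Fin n) → toℕ i < 3 + m
    toℕ<length i = subst (toℕ i <_) (sym length≡n) (toℕ<n i)

    enumeration : Fin n ↔ Fin n
    enumeration = mk↔ₛ′ to from to∘from from∘to
      where
      to : Fin n → Fin n
      to i = vertex (toℕ i)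

      from : Fin n → Fin n
      from z = cast length≡n (proj₁ (onCycle z))

      to∘from : ∀ z → to (from z) ≡ z
      to∘from z = trans (cong vertex (toℕ-cast length≡n _)) (proj₂ (onCycle z))

      from∘to : ∀ i → from (to i) ≡ i
      from∘to i = toℕ-injective (trans (toℕ-cast length≡n _)
                    (injective (toℕ<n _) (toℕ<length i) (proj₂ (onCycle (to i)))))

    ascending-adj⇒cycAdj : ∀ {i j} → toℕ i < toℕ j → Adj G (vertex (toℕ i)) (vertex (toℕ j)) →
                           CycAdj G i j
    ascending-adj⇒cycAdj {i} {j} i<j vᵢ~vⱼ with chordless i<j (toℕ<length j) vᵢ~vⱼ
    ... | inj₁ j≡1+i          = inj₁ (inj₁ j≡1+i)
    ... | inj₂ (i≡0 , 1+j≡k) = inj₂ (inj₂ (trans 1+j≡k length≡n , i≡0))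

    adj⇒cycAdj : ∀ i j → Adj G (vertex (toℕ i)) (vertex (toℕ j)) → CycAdj G i j
    adj⇒cycAdj i j vᵢ~vⱼ with <-cmp (toℕ i) (toℕ j)
    ... | tri< i<j _ _ = ascending-adj⇒cycAdj i<j vᵢ~vⱼ
    ... | tri≈ _ i≡j _ = ⊥-elim (Adj⇒≢ vᵢ~vⱼ (cong vertex i≡j))
    ... | tri> _ _ j<i = Sum.swap (ascending-adj⇒cycAdj j<i (Adj-sym vᵢ~vⱼ))

    successor-adj : ∀ (i j : Fin n) → toℕ j ≡ suc (toℕ i) →
                    Adj G (vertex (toℕ i)) (vertex (toℕ j))
    successor-adj i j j≡1+i = subst (λ t → Adj G (vertex (toℕ i)) (vertex t)) (sym j≡1+i) (step (toℕ i))

    wrap-adj : ∀ (i j : Fin n) → suc (toℕ i) ≡ n → toℕ j ≡ 0 →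
               Adj G (vertex (toℕ i)) (vertex (toℕ j))
    wrap-adj i j 1+i≡n j≡0 = subst (Adj G (vertex (toℕ i)))
      (trans (cong vertex (trans 1+i≡n (sym length≡n))) (trans (periodic 0) (cong vertex (sym j≡0))))
      (step (toℕ i))

    cycAdj⇒adj : ∀ i j → CycAdj G i j → Adj G (vertex (toℕ i)) (vertex (toℕ j))
    cycAdj⇒adj i j (inj₁ (inj₁ j≡1+i))          = successor-adj i j j≡1+i
    cycAdj⇒adj i j (inj₁ (inj₂ (1+i≡n , j≡0))) = wrap-adj i j 1+i≡n j≡0
    cycAdj⇒adj i j (inj₂ (inj₁ i≡1+j))          = Adj-sym (successor-adj j i i≡1+j)
    cycAdj⇒adj i j (inj₂ (inj₂ (1+j≡n , i≡0))) = Adj-sym (wrap-adj j i 1+j≡n i≡0)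

    isCycle : IsCycle G
    isCycle = subst (3 ≤_) length≡n (m≤m+n 3 m) , enumeration ,
              λ i j → mk⇔ (adj⇒cycAdj i j) (cycAdj⇒adj i j)

  branchedCycle : Connected G → ¬ IsTree G → ¬ IsCycle G → BranchedCycle
  branchedCycle connected ¬tree ¬cycle = decidable-stable branchedCycle? λ ¬branched →
    ¬tree (connected , λ hasCycle →
      let _ , C = hasCycle⇒cycle hasCycle in ¬cycle (isCycle connected ¬branched C))

module LabelingProperties {c ℓ : Level} (R : CommutativeRing c ℓ) {n : ℕ} (G : SimpleGraph n) where
  open CommutativeRing R
  open IdealProperties R
  open GraphProperties G using (Adj-sym; Adj⇒≢; Reach; BranchedCycle)
  open import Data.Nat using (zero; suc)
  open import Data.Fin using (_≤?_)
  open import Relation.Binary.PropositionalEquality using () renaming (refl to ≡-refl; sym to ≡-sym)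

  label-∈⁺ : ∀ (α : EdgeLabeling R G) → (∀ {p q x} → x ∈ᵢ α p q → x ∈ᵢ α q p) →
             ∀ {p q x} → x ∈ᵢ α p q → x ∈ᵢ label R G α p q
  label-∈⁺ α α-sym {p} {q} x∈ with p ≤? q
  ... | yes _ = x∈
  ... | no  _ = α-sym x∈

  label-∈⁻ : ∀ (α : EdgeLabeling R G) → (∀ {p q x} → x ∈ᵢ α p q → x ∈ᵢ α q p) →
             ∀ {p q x} → x ∈ᵢ label R G α p q → x ∈ᵢ α p q
  label-∈⁻ α α-sym {p} {q} x∈ with p ≤? q
  ... | yes _ = x∈
  ... | no  _ = α-sym x∈

  0∈Sum : ∀ α {p q} (P : Walk G p q) → _∈Sum_ R G 0# (α , P)
  0∈Sum α []                 = lift refl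
  0∈Sum α (_∷_ {p} {b} _ P) = 0# , 0# , 0∈ (label R G α p b) , 0∈Sum α P , sym (+-identityʳ 0#)

  ∈Sum-last : ∀ α {p b q} (p~b : Adj G p b) (P : Walk G b q) →
              ∃[ r ] (∀ {z} → z ∈ᵢ label R G α r q → _∈Sum_ R G z (α , p~b ∷ P))
  ∈Sum-last α {p} _ []          = p , λ {z} z∈ → z , 0# , z∈ , lift refl , sym (+-identityʳ z)
  ∈Sum-last α {p} {b} _ (b~c ∷ P) =
    let r , last = ∈Sum-last α b~c P
    in r , λ {z} z∈ → 0# , z , 0∈ (label R G α p b) , last z∈ , sym (+-identityˡ z)

  Reach⇒-∈ : ∀ (K : Ideal R) (ρ : Fin n → Carrier) {P : Fin n → Set} →
             (∀ {p q} → P p → P q → Adj G p q → ρ p - ρ q ∈ᵢ K) →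
             ∀ m {a b} → P a → Reach P m a b → ρ a - ρ b ∈ᵢ K
  Reach⇒-∈ K ρ edge zero    _  ≡-refl                       = x-x∈ K (ρ _)
  Reach⇒-∈ K ρ edge (suc m) _  (inj₁ ≡-refl)                = x-x∈ K (ρ _)
  Reach⇒-∈ K ρ edge (suc m) Pa (inj₂ (d , a~d , Pd , d⇝b)) =
    ∈-resp-≈ K ([x-y]+[y-z]≈x-z _ _ _) (+-closed K (edge Pa Pd a~d) (Reach⇒-∈ K ρ edge m Pd d⇝b))

  SameEdge : Fin n → Fin n → Fin n → Fin n → Set
  SameEdge p q r s = (p ≡ r × q ≡ s) ⊎ (p ≡ s × q ≡ r)

  SameEdge-swap : ∀ {p q r s} → SameEdge p q r s → SameEdge q p r s
  SameEdge-swap = Sum.swap ∘ Sum.map Prod.swap Prod.swap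

  module BranchedCycleLabeling (B : BranchedCycle) (I J K : Ideal R) where
    open BranchedCycle B

    Avoids-y : Fin n → Fin n → Set
    Avoids-y p q = p ≢ y × q ≢ y

    α : EdgeLabeling R G
    α p q = SameEdge p q y v ⇒ᵢ I
         ∩ᵢ (Avoids-y p q × SameEdge p q v w) ⇒ᵢ J
         ∩ᵢ (Avoids-y p q × ¬ SameEdge p q v w) ⇒ᵢ K

    α-sym : ∀ {p q x} → x ∈ᵢ α p q → x ∈ᵢ α q p
    α-sym (x∈I , x∈J , x∈K) =
        (λ pq≡yv → x∈I (SameEdge-swap pq≡yv))
      , (λ ((q≢y , p≢y) , pq≡vw) → x∈J ((p≢y , q≢y) , SameEdge-swap pq≡vw))
      , (λ ((q≢y , p≢y) , pq≢vw) → x∈K ((p≢y , q≢y) , pq≢vw ∘ SameEdge-swap))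

    ∈label⁺ : ∀ {p q x} → x ∈ᵢ α p q → x ∈ᵢ label R G α p q
    ∈label⁺ = label-∈⁺ α α-sym

    ∈label⁻ : ∀ {p q x} → x ∈ᵢ label R G α p q → x ∈ᵢ α p q
    ∈label⁻ = label-∈⁻ α α-sym

    v≢y : v ≢ y
    v≢y = Adj⇒≢ (Adj-sym y~v)

    w≢v : w ≢ v
    w≢v = Adj⇒≢ (Adj-sym v~w)

    a≢v : a ≢ v
    a≢v = Adj⇒≢ (Adj-sym v~a)

    ¬Avoids-y-y· : ∀ {q} → ¬ Avoids-y y q
    ¬Avoids-y-y· (y≢y , _) = y≢y ≡-refl

    ·w≢yv : ∀ {p} → ¬ SameEdge p w y v
    ·w≢yv (inj₁ (_ , w≡v)) = w≢v w≡v
    ·w≢yv (inj₂ (_ , w≡y)) = w≢y w≡y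

    I⊆α-yv : ∀ {x} → x ∈ᵢ I → x ∈ᵢ α y v
    I⊆α-yv x∈I = (λ _ → x∈I) , ⊥-elim ∘ ¬Avoids-y-y· ∘ proj₁ , ⊥-elim ∘ ¬Avoids-y-y· ∘ proj₁

    J⊆α-vw : ∀ {x} → x ∈ᵢ J → x ∈ᵢ α v w
    J⊆α-vw x∈J = ⊥-elim ∘ ·w≢yv , (λ _ → x∈J) , λ (_ , vw≢vw) → ⊥-elim (vw≢vw (inj₁ (≡-refl , ≡-refl)))

    K⊆α-·w : ∀ {p x} → p ≢ v → x ∈ᵢ K → x ∈ᵢ α p w
    K⊆α-·w {p} p≢v x∈K = ⊥-elim ∘ ·w≢yv , ⊥-elim ∘ pw≢vw ∘ proj₂ , λ _ → x∈K
      where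
      pw≢vw : ¬ SameEdge p w v w
      pw≢vw (inj₁ (p≡v , _)) = p≢v p≡v
      pw≢vw (inj₂ (_ , w≡v)) = w≢v w≡v

    ∈α-y· : ∀ {b x} → b ≢ v → x ∈ᵢ α y b
    ∈α-y· {b} b≢v = ⊥-elim ∘ yb≢yv , ⊥-elim ∘ ¬Avoids-y-y· ∘ proj₁ , ⊥-elim ∘ ¬Avoids-y-y· ∘ proj₁
      where
      yb≢yv : ¬ SameEdge y b y v
      yb≢yv (inj₁ (_ , b≡v)) = b≢v b≡v
      yb≢yv (inj₂ (y≡v , _)) = v≢y (≡-sym y≡v)

    α-yv⊆I : ∀ {x} → x ∈ᵢ α y v → x ∈ᵢ I
    α-yv⊆I (x∈I , _) = x∈I (inj₁ (≡-refl , ≡-refl))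

    α-vw⊆J : ∀ {x} → x ∈ᵢ α v w → x ∈ᵢ J
    α-vw⊆J (_ , x∈J , _) = x∈J ((v≢y , w≢y) , inj₁ (≡-refl , ≡-refl))

    α⊆K : ∀ {p q x} → p ≢ y → q ≢ y → ¬ SameEdge p q v w → x ∈ᵢ α p q → x ∈ᵢ K
    α⊆K p≢y q≢y pq≢vw (_ , _ , x∈K) = x∈K ((p≢y , q≢y) , pq≢vw)

    v⇝w-∈Sum : ∀ {j k q} → j ∈ᵢ J → k ∈ᵢ K → (P : Walk G v q) → q ≡ w →
               _∈Sum_ R G j (α , P) ⊎ _∈Sum_ R G k (α , P)
    v⇝w-∈Sum _   _   []          v≡w    = ⊥-elim (w≢v (≡-sym v≡w))
    v⇝w-∈Sum j∈J k∈K (v~c ∷ P) ≡-refl with ∈Sum-last α v~c P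
    ... | r , last with r ≟ v
    ...   | yes ≡-refl = inj₁ (last (∈label⁺ (J⊆α-vw j∈J)))
    ...   | no  r≢v    = inj₂ (last (∈label⁺ (K⊆α-·w r≢v k∈K)))

    ⊕⇒∈Sum : ∀ {x} → x ∈ I ⊕ J → x ∈ I ⊕ K →
             ∀ {q} (P : Walk G y q) → q ≡ w → _∈Sum_ R G x (α , P)
    ⊕⇒∈Sum {x} (i₁ , j , i₁∈I , j∈J , x≈i₁+j) (i₂ , k , i₂∈I , k∈K , x≈i₂+k) = go
      where
      go : ∀ {q} (P : Walk G y q) → q ≡ w → _∈Sum_ R G x (α , P)
      go [] y≡w = ⊥-elim (w≢y (≡-sym y≡w))
      go (_∷_ {v = b} _ P) q≡w with b ≟ v
      ... | no  b≢v = x , 0# , ∈label⁺ (∈α-y· b≢v) , 0∈Sum α P , sym (+-identityʳ x)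
      ... | yes ≡-refl with v⇝w-∈Sum j∈J k∈K P q≡w
      ...   | inj₁ j∈ΣP = i₁ , j , ∈label⁺ (I⊆α-yv i₁∈I) , j∈ΣP , x≈i₁+j
      ...   | inj₂ k∈ΣP = i₂ , k , ∈label⁺ (I⊆α-yv i₂∈I) , k∈ΣP , x≈i₂+k

    module _ {ρ : Fin n → Carrier} (spline : IsSpline R G α ρ) where

      ρ-yv∈I : ρ y - ρ v ∈ᵢ I
      ρ-yv∈I = α-yv⊆I (∈label⁻ (spline y v y~v))

      ρ-vw∈J : ρ v - ρ w ∈ᵢ J
      ρ-vw∈J = α-vw⊆J (∈label⁻ (spline v w v~w))

      ρ-vw∈K : ρ v - ρ w ∈ᵢ K
      ρ-vw∈K = ∈-resp-≈ K ([x-y]+[y-z]≈x-z _ _ _)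
        (+-closed K (edge∈K v≢y a≢y va≢vw v~a) (Reach⇒-∈ K ρ inner-edge∈K n (a≢y , a≢v) a⇝w))
        where
        edge∈K : ∀ {p q} → p ≢ y → q ≢ y → ¬ SameEdge p q v w → Adj G p q → ρ p - ρ q ∈ᵢ K
        edge∈K p≢y q≢y pq≢vw p~q = α⊆K p≢y q≢y pq≢vw (∈label⁻ (spline _ _ p~q))

        va≢vw : ¬ SameEdge v a v w
        va≢vw (inj₁ (_ , a≡w))  = a≢w a≡w
        va≢vw (inj₂ (v≡w , _)) = w≢v (≡-sym v≡w)

        inner-edge∈K : ∀ {p q} → p ≢ y × p ≢ v → q ≢ y × q ≢ v → Adj G p q → ρ p - ρ q ∈ᵢ K
        inner-edge∈K (p≢y , p≢v) (q≢y , q≢v) = edge∈K p≢y q≢y λ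
          { (inj₁ (p≡v , _)) → p≢v p≡v
          ; (inj₂ (_ , q≡v)) → q≢v q≡v }

  branchedCycle⇒dualDistributive : BranchedCycle →
    (∀ α → UniversalDifferenceProperty R G α) → DualDistributive
  branchedCycle⇒dualDistributive B udp I J K x∈I⊕J x∈I⊕K =
    let ρ , spline , ρy-ρw≈x = udp α y w _ (λ (P , _) → ⊕⇒∈Sum x∈I⊕J x∈I⊕K P ≡-refl)
    in ρ y - ρ v , ρ v - ρ w , ρ-yv∈I spline , (ρ-vw∈J spline , ρ-vw∈K spline) ,
       trans (sym ρy-ρw≈x) (sym ([x-y]+[y-z]≈x-z _ _ _))
    where
    open BranchedCycle B
    open BranchedCycleLabeling B I J K

theorem5p4 : {c ℓ : Level} (R : CommutativeRing c ℓ) → IsIntegralDomain R →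
    (Σ ℕ λ n → Σ (SimpleGraph n) λ G →
      Connected G × ¬ IsTree G × ¬ IsCycle G ×
      (∀ (α : EdgeLabeling R G) → UniversalDifferenceProperty R G α)) →
    IsPruferDomain R
theorem5p4 R domain (_ , G , connected , ¬tree , ¬cycle , udp) =
  dualDistributive⇒Prüfer domain
    (branchedCycle⇒dualDistributive (branchedCycle connected ¬tree ¬cycle) udp)
  where
  open IdealProperties R
  open GraphProperties G
  open LabelingProperties R G
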